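{- Let $(G,\mathcal{H})$ be a graph system with an embedding of $G$ on an orientable surface that is cross-free with respect to $\mathcal{H}$, where members of $\mathcal{H}$ are connected induced subgraphs. Let $v\in V(G)$ and let $v_0,\dots,v_{k-1}$ be the neighbors of $v$ in their cyclic order around $v$ in the embedding. Place elements $u_0,\dots,u_{k-1}$ on a cycle $C$ in this cyclic order, and for each $H\in\mathcal{H}$ with $v\in V(H)$ let $S_H=\{u_i: v_i\in V(H)\}$ (equivalently, $u_i\in S_H$ iff the edge $\{v,v_i\}$ lies in $H$). Then the hypergraph $(\{u_0,\dots,u_{k-1}\},\{S_H: H\in\mathcal{H}, v\in V(H)\})$ is $abab$-free with respect to the cyclic order of $C$: there are no $H,H'$ and distinct $x_1,x_2,x_3,x_4$ in this cyclic order on $C$ with $x_1,x_3\in S_H\setminus S_{H'}$ and $x_2,x_4\in S_{H'}\setminus S_H$.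
   Context: Reduced graph $R(H,H')$: contract all edges of $G$ with both endpoints in $V(H)\cap V(H')$. $H,H'$ are cross-free at $w\in V(H)\cap V(H')$ if in $R(H,H')$ there are no four edges $\{\tilde w,w_i\}$ around the image $\tilde w$ of $w$, in cyclic order $i=1,\dots,4$, with $w_1,w_3\in V(H)\setminus V(H')$, $w_2,w_4\in V(H')\setminus V(H)$. The embedding is cross-free w.r.t. $\mathcal{H}$ if every pair is cross-free at every common vertex. (In the paper, $u_i$ is the vertex subdividing edge $\{v,v_i\}$ when $v$ is deleted and the subdividing vertices are joined in a cycle.) -}

module Defs where

open import Data.Nat using (ℕ; zero; suc; _<_; _≤_)
open import Data.Bool using (Bool; true; false; if_then_else_; _∧_; _∨_; not)
open import Data.Fin using (Fin; _≟_)
open import Data.Fin.Subset using (Subset; _∈_; _∉_)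
open import Data.Fin.Subset.Properties using (_∈?_)
open import Data.List using (List; []; _∷_)
open import Data.List.Membership.Propositional using () renaming (_∈_ to _∈ₗ_)
open import Data.List.Relation.Unary.Unique.Propositional using (Unique)
open import Data.Product using (Σ; ∃; _×_; _,_; proj₁; proj₂)
open import Relation.Nullary using (¬_)
open import Relation.Nullary.Decidable using (⌊_⌋)
open import Relation.Binary.PropositionalEquality using (_≡_; _≢_)

-- Embeddings of a finite simple graph on an orientable surface, given
-- combinatorially by a rotation system (Heffter–Edmonds): for every
-- vertex v, the list  rot v  of its neighbours in cyclic (clockwise)
-- order around v.

record RotSys (n : ℕ) : Set where
  field
    rot       : Fin n → List (Fin n)
    rot-uniq  : ∀ v → Unique (rot v)
    rot-sym   : ∀ u w → w ∈ₗ rot u → u ∈ₗ rot w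
    rot-irrefl : ∀ v → ¬ (v ∈ₗ rot v)
open RotSys public

module _ {n : ℕ} where

  Adj : RotSys n → Fin n → Fin n → Set
  Adj G u w = w ∈ₗ rot G u

  -- cyclic successor of b in a list (the list read cyclically);
  -- returns b itself if b does not occur.
  succIn : List (Fin n) → Fin n → Fin n
  succIn [] b = b
  succIn (x ∷ xs) b = go (x ∷ xs)
    where
    go : List (Fin n) → Fin n
    go [] = b
    go (y ∷ []) = if ⌊ y ≟ b ⌋ then x else b
    go (y ∷ z ∷ zs) = if ⌊ y ≟ b ⌋ then z else go (z ∷ zs)

  iter : {A : Set} → (A → A) → ℕ → A → A
  iter f zero a = a
  iter f (suc k) a = f (iter f k a)

  -- x1, x2, x3, x4 are distinct and occur in this cyclic order along
  -- the cyclic permutation f (orbit of x1): going around from x1 one meets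
  -- x2, then x3, then x4, before coming back to x1.
  CycOrd : {A : Set} → (A → A) → A → A → A → A → Set
  CycOrd f x₁ x₂ x₃ x₄ =
    Σ ℕ λ i → Σ ℕ λ j → Σ ℕ λ k →
      (0 < i) × (i < j) × (j < k) ×
      (iter f i x₁ ≡ x₂) × (iter f j x₁ ≡ x₃) × (iter f k x₁ ≡ x₄) ×
      (∀ l → 0 < l → l ≤ k → iter f l x₁ ≢ x₁)

  data PathIn (G : RotSys n) (S : Subset n) : Fin n → Fin n → Set where
    here : ∀ {x} → x ∈ S → PathIn G S x x
    step : ∀ {x y z} → x ∈ S → Adj G x y → PathIn G S y z → PathIn G S x z

  ConnectedIn : RotSys n → Subset n → Set
  ConnectedIn G S = ∀ x y → x ∈ S → y ∈ S → PathIn G S x y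

  -- The reduced graph R(H,H') around the image w̃ of w ∈ V(H) ∩ V(H').
  -- Contracting the edges inside the component X of G[V(H) ∩ V(H')]
  -- containing w is done (in the embedding) by contracting a spanning
  -- tree of X; the rotation at w̃ is then read off by walking around that
  -- tree.  A spanning tree of X is given by parent pointers with a
  -- strictly decreasing depth (root w); `inT` is exactly X.

  Dart : Set
  Dart = Fin n × Fin n

  record SpanTree (G : RotSys n) (A B : Subset n) (w : Fin n) : Set where
    field
      inT       : Subset n
      parent    : Fin n → Fin n
      depth     : Fin n → ℕ
      root-in   : w ∈ inT
      inT-A     : ∀ x → x ∈ inT → x ∈ A
      inT-B     : ∀ x → x ∈ inT → x ∈ B
      inT-closed : ∀ x y → x ∈ inT → y ∈ A → y ∈ B → Adj G x y → y ∈ inT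
      par-in    : ∀ x → x ∈ inT → x ≢ w → parent x ∈ inT
      par-adj   : ∀ x → x ∈ inT → x ≢ w → Adj G x (parent x)
      par-depth : ∀ x → x ∈ inT → x ≢ w → depth (parent x) < depth x
  open SpanTree public

  module _ {G : RotSys n} {A B : Subset n} {w : Fin n} (t : SpanTree G A B w) where

    isChild : Fin n → Fin n → Bool
    isChild a b = ⌊ a ∈? inT t ⌋ ∧ not ⌊ a ≟ w ⌋ ∧ ⌊ parent t a ≟ b ⌋

    isTreeEdge : Fin n → Fin n → Bool
    isTreeEdge a b = isChild a b ∨ isChild b a

    -- one step of the walk around the contracted tree: a tree dart is
    -- crossed, any other dart is rotated past.
    turn : Dart → Dart
    turn (a , b) =
      if isTreeEdge a b then (b , succIn (rot G b) a)
                        else (a , succIn (rot G a) b)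

    -- four edges {w̃,w₁},…,{w̃,w₄} of R(H,H') (darts (aᵢ,wᵢ) with aᵢ ∈ X)
    -- in cyclic order around w̃, w₁,w₃ ∈ V(H)∖V(H'), w₂,w₄ ∈ V(H')∖V(H)
    Crossing : Set
    Crossing =
      Σ Dart λ d₁ → Σ Dart λ d₂ → Σ Dart λ d₃ → Σ Dart λ d₄ →
        (proj₁ d₁ ∈ inT t) × (proj₁ d₂ ∈ inT t) ×
        (proj₁ d₃ ∈ inT t) × (proj₁ d₄ ∈ inT t) ×
        Adj G (proj₁ d₁) (proj₂ d₁) × Adj G (proj₁ d₂) (proj₂ d₂) ×
        Adj G (proj₁ d₃) (proj₂ d₃) × Adj G (proj₁ d₄) (proj₂ d₄) ×
        (proj₂ d₁ ∈ A) × (proj₂ d₁ ∉ B) × (proj₂ d₃ ∈ A) × (proj₂ d₃ ∉ B) ×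
        (proj₂ d₂ ∈ B) × (proj₂ d₂ ∉ A) × (proj₂ d₄ ∈ B) × (proj₂ d₄ ∉ A) ×
        CycOrd turn d₁ d₂ d₃ d₄

  CrossFreeAt : RotSys n → Subset n → Subset n → Fin n → Set
  CrossFreeAt G A B w = Σ (SpanTree G A B w) λ t → ¬ Crossing t

  -- the embedding is cross-free w.r.t. the family V (members given by
  -- their vertex sets, as they are induced subgraphs)
  CrossFree : RotSys n → {ι : Set} → (ι → Subset n) → Set
  CrossFree G {ι} V = ∀ (i j : ι) (w : Fin n) → w ∈ V i → w ∈ V j →
                      CrossFreeAt G (V i) (V j) w

  -- abab-freeness of a hypergraph on the cycle C (given as a cyclically
  -- ordered list of distinct elements) with hyperedges S e, e : κ.

  AbabFree : List (Fin n) → (κ : Set) → (κ → Fin n → Set) → Set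
  AbabFree C κ S =
    ¬ (Σ κ λ e → Σ κ λ e' →
       Σ (Fin n) λ x₁ → Σ (Fin n) λ x₂ → Σ (Fin n) λ x₃ → Σ (Fin n) λ x₄ →
         (x₁ ∈ₗ C) × (x₂ ∈ₗ C) × (x₃ ∈ₗ C) × (x₄ ∈ₗ C) ×
         S e x₁ × ¬ S e' x₁ × S e x₃ × ¬ S e' x₃ ×
         S e' x₂ × ¬ S e x₂ × S e' x₄ × ¬ S e x₄ ×
         CycOrd (succIn C) x₁ x₂ x₃ x₄)

{-# OPTIONS --safe #-}
module Submission where

-- Contract the component X of G[V(H) ∩ V(H')] containing v along its
-- spanning tree and walk around the contracted vertex (turn).  Leaving v along
-- an edge {v, y}, the walk goes around the subtree hanging from y (if y is a
-- child of v) and comes back to v exactly at the next edge {v, y⁺} of the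
-- rotation at v.  So the rotation at v is the first-return map of the walk on
-- the darts at v, and an abab pattern among the neighbours of v is an abab
-- pattern of edges around the contracted vertex, i.e. a crossing of H and H'
-- at v.

open import Defs
open import Data.Bool using (true; false; if_then_else_; _∨_)
open import Data.Bool.Properties using (¬-not)
open import Data.Fin using (Fin; _≟_)
open import Data.Fin.Subset using (Subset; _∈_)
open import Data.Fin.Subset.Properties using (_∈?_)
open import Data.List using (List; []; _∷_; _++_; [_]; length; head; map; allFin)
open import Data.List.Extrema.Nat using (max; xs≤max)
open import Data.List.Membership.Propositional using () renaming (_∈_ to _∈ₗ_)
open import Data.List.Membership.Propositional.Properties using (∈-∃++; ∈-++⁺ʳ; ∈-allFin)
open import Data.List.Properties using (++-assoc; ++-identityʳ)
open import Data.List.Relation.Unary.All as All using ()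
open import Data.List.Relation.Unary.All.Properties using (map⁻)
open import Data.List.Relation.Unary.AllPairs using (_∷_)
open import Data.List.Relation.Unary.Any using (here)
open import Data.List.Relation.Unary.Unique.Propositional using (Unique)
open import Data.Maybe using (fromMaybe)
open import Data.Nat using (ℕ; zero; suc; _+_; _∸_; _<_; _≤_; _<′_; ≤′-refl; ≤′-step; z≤n; s≤s; z<s)
open import Data.Nat.Induction using (<-wellFounded)
open import Data.Nat.Properties
  using (≤-refl; ≤-pred; <-trans; <-irrefl; _≤?_; ≰⇒>; m≤n⇒m≤1+n; m≤n⇒m<n∨m≡n;
         m≤n⇒∃[o]m+o≡n; n≤0⇒n≡0; +-comm; +-cancelʳ-≤; m<n+m; ∸-monoʳ-<; <⇒<′)
open import Data.Product using (Σ; ∃-syntax; _×_; _,_; proj₁; proj₂)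
open import Data.Sum using (inj₁; inj₂)
open import Function using (_∘_; id)
open import Function.Definitions using (Injective)
open import Induction.WellFounded using (WellFounded; Acc; acc; module Subrelation)
open import Relation.Binary.Construct.Closure.ReflexiveTransitive using (Star; ε; _◅_; _◅◅_)
open import Relation.Binary.Construct.On as On using ()
open import Relation.Binary.PropositionalEquality
  using (_≡_; _≢_; refl; sym; trans; cong; cong₂; subst; module ≡-Reasoning)
open import Relation.Nullary using (¬_; yes; no; contradiction)
open import Relation.Nullary.Decidable using (⌊_⌋)

-- Defs' iter takes an implicit n that it does not use; it cannot be inferred
-- and is written iter {n} throughout.
module _ {n : ℕ} where

  module _ {A : Set} (f : A → A) where

    iter-suc : ∀ k a → iter {n} f (suc k) a ≡ iter {n} f k (f a)
    iter-suc zero    a = refl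
    iter-suc (suc k) a = cong f (iter-suc k a)

    iter-+ : ∀ k l a → iter {n} f (k + l) a ≡ iter {n} f k (iter {n} f l a)
    iter-+ zero    l a = refl
    iter-+ (suc k) l a = cong f (iter-+ k l a)

  iter-semiconj : ∀ {A B : Set} {f : A → A} {g : B → B} (h : A → B) →
                  (∀ a → h (f a) ≡ g (h a)) →
                  ∀ k a → h (iter {n} f k a) ≡ iter {n} g k (h a)
  iter-semiconj h comm zero    a = refl
  iter-semiconj {f = f} {g} h comm (suc k) a =
    trans (comm (iter {n} f k a)) (cong g (iter-semiconj h comm k a))

  CycOrd-map : ∀ {A B : Set} {f : A → A} {g : B → B} {x₁ x₂ x₃ x₄ : A}
               (h : A → B) → Injective _≡_ _≡_ h → (∀ a → h (f a) ≡ g (h a)) →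
               CycOrd {n} f x₁ x₂ x₃ x₄ → CycOrd {n} g (h x₁) (h x₂) (h x₃) (h x₄)
  CycOrd-map {f = f} {g} {x₁} h h-inj comm
             (i , j , k , 0<i , i<j , j<k , fi , fj , fk , no-return) =
    i , j , k , 0<i , i<j , j<k , moved i fi , moved j fj , moved k fk ,
    λ l 0<l l≤k gl≡ → no-return l 0<l l≤k (h-inj (trans (iter-semiconj h comm l x₁) gl≡))
    where
    moved : ∀ l {x} → iter {n} f l x₁ ≡ x → iter {n} g l (h x₁) ≡ h x
    moved l e = trans (sym (iter-semiconj h comm l x₁)) (cong h e)

  module _ {A : Set} (f : A → A) (P : A → Set) where

    StepOutside : A → A → Set
    StepOutside x y = ¬ P x × f x ≡ y

    AvoidsFor : ℕ → A → Set
    AvoidsFor m x = ∀ s → s < m → ¬ P (iter {n} f s x)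

    star⇒iter : ∀ {x y} → Star StepOutside x y → ∃[ m ] iter {n} f m x ≡ y × AvoidsFor m x
    star⇒iter ε = 0 , refl , λ _ ()
    star⇒iter {x} ((¬Px , refl) ◅ steps) with m , fm≡y , avoids ← star⇒iter steps =
      suc m , trans (iter-suc f m x) fm≡y , avoids′
      where
      avoids′ : AvoidsFor (suc m) x
      avoids′ zero    _         = ¬Px
      avoids′ (suc s) (s≤s s<m) = avoids s s<m ∘ subst P (iter-suc f s x)

  <⇒≡suc+ : ∀ {m k} → m < k → ∃[ u ] k ≡ suc u + m
  <⇒≡suc+ {m} m<k with u , refl ← m≤n⇒∃[o]m+o≡n m<k = u , cong suc (+-comm m u)

  module FirstReturn {A : Set} {f g : A → A} {P : A → Set}
      (P-g : ∀ {x} → P x → P (g x))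
      (returns : ∀ {x} → P x → Star (StepOutside f P) (f x) (g x))
      {x₁ : A} (P-x₁ : P x₁) where

    P-orbit : ∀ l → P (iter {n} g l x₁)
    P-orbit zero    = P-x₁
    P-orbit (suc l) = P-g (P-orbit l)

    leg : ∀ l → ∃[ m ] iter {n} f m (f (iter {n} g l x₁)) ≡ iter {n} g (suc l) x₁
                             × AvoidsFor f P m (f (iter {n} g l x₁))
    leg l = star⇒iter f P (returns (P-orbit l))

    time : ℕ → ℕ
    time zero    = 0
    time (suc l) = suc (proj₁ (leg l)) + time l

    iter-time+ : ∀ l u → iter {n} f (suc u + time l) x₁ ≡ iter {n} f u (f (iter {n} g l x₁))
    iter-time : ∀ l → iter {n} f (time l) x₁ ≡ iter {n} g l x₁

    iter-time+ l u = begin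
      iter {n} f (suc u + time l) x₁                 ≡⟨ iter-+ f (suc u) (time l) x₁ ⟩
      iter {n} f (suc u) (iter {n} f (time l) x₁)  ≡⟨ cong (iter {n} f (suc u)) (iter-time l) ⟩
      iter {n} f (suc u) (iter {n} g l x₁)         ≡⟨ iter-suc f u _ ⟩
      iter {n} f u (f (iter {n} g l x₁))           ∎
      where open ≡-Reasoning

    iter-time zero    = refl
    iter-time (suc l) = trans (iter-time+ l (proj₁ (leg l))) (proj₁ (proj₂ (leg l)))

    time-step : ∀ l → time l < time (suc l)
    time-step l = m<n+m (time l) z<s

    time-mono : ∀ {i j} → i <′ j → time i < time j
    time-mono {i}         ≤′-refl        = time-step i
    time-mono {j = suc j} (≤′-step i<′j) = <-trans (time-mono i<′j) (time-step j)

    visits-only-at-time : ∀ l s → s ≤ time l → P (iter {n} f s x₁) →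
                          ∃[ l′ ] l′ ≤ l × s ≡ time l′
    visits-only-at-time zero    s s≤0 _ = 0 , z≤n , n≤0⇒n≡0 s≤0
    visits-only-at-time (suc l) s s≤ P-s with s ≤? time l
    ... | yes s≤t with l′ , l′≤l , s≡ ← visits-only-at-time l s s≤t P-s =
      l′ , m≤n⇒m≤1+n l′≤l , s≡
    ... | no s≰t with u , refl ← <⇒≡suc+ (≰⇒> s≰t)
                 with m≤n⇒m<n∨m≡n (≤-pred (+-cancelʳ-≤ (time l) (suc u) _ s≤))
    ...   | inj₁ u<m = contradiction (subst P (iter-time+ l u) P-s) (proj₂ (proj₂ (leg l)) u u<m)
    ...   | inj₂ refl = suc l , ≤-refl , refl

    CycOrd-firstReturn : ∀ {x₂ x₃ x₄} → CycOrd {n} g x₁ x₂ x₃ x₄ → CycOrd {n} f x₁ x₂ x₃ x₄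
    CycOrd-firstReturn (i , j , k , 0<i , i<j , j<k , gi , gj , gk , g-no-return) =
      time i , time j , time k ,
      time-mono (<⇒<′ 0<i) , time-mono (<⇒<′ i<j) , time-mono (<⇒<′ j<k) ,
      trans (iter-time i) gi , trans (iter-time j) gj , trans (iter-time k) gk , no-return
      where
      no-return : ∀ l → 0 < l → l ≤ time k → iter {n} f l x₁ ≢ x₁
      no-return l 0<l l≤ fl≡x₁ with visits-only-at-time k l l≤ (subst P (sym fl≡x₁) P-x₁)
      ... | zero   , _    , refl = <-irrefl refl 0<l
      ... | suc l′ , l′≤k , refl =
        g-no-return (suc l′) z<s l′≤k (trans (sym (iter-time (suc l′))) fl≡x₁)

  after : Fin n → Fin n → List (Fin n) → Fin n
  after x b []       = b
  after x b (y ∷ ys) = if ⌊ y ≟ b ⌋ then fromMaybe x (head ys) else after x b ys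

  after-≗ : ∀ x b (go : List (Fin n) → Fin n) → go [] ≡ b →
            (∀ y → go (y ∷ []) ≡ (if ⌊ y ≟ b ⌋ then x else b)) →
            (∀ y z zs → go (y ∷ z ∷ zs) ≡ (if ⌊ y ≟ b ⌋ then z else go (z ∷ zs))) →
            ∀ ys → go ys ≡ after x b ys
  after-≗ x b go go-[] go-[y] go-∷ []           = go-[]
  after-≗ x b go go-[] go-[y] go-∷ (y ∷ [])     = go-[y] y
  after-≗ x b go go-[] go-[y] go-∷ (y ∷ z ∷ zs) =
    trans (go-∷ y z zs)
      (cong (if ⌊ y ≟ b ⌋ then z else_) (after-≗ x b go go-[] go-[y] go-∷ (z ∷ zs)))

  -- succIn is defined through a helper local to its where-block.  It is
  -- captured by unification once the list is generalised (with), which makes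
  -- the constraint a pattern.
  succIn-∷ : ∀ x xs b → succIn (x ∷ xs) b ≡ after x b (x ∷ xs)
  succIn-∷ x xs b = trans unfold (after-≗ x b go refl (λ _ → refl) (λ _ _ _ → refl) (x ∷ xs))
    where
    go : List (Fin n) → Fin n
    go = _
    unfold : succIn (x ∷ xs) b ≡ go (x ∷ xs)
    unfold with x ∷ xs
    ... | ys = refl

  after-++-∷ : ∀ x pre {q rest} → Unique (pre ++ q ∷ rest) →
               after x q (pre ++ q ∷ rest) ≡ fromMaybe x (head rest)
  after-++-∷ x []        {q} _ with q ≟ q
  ... | yes _   = refl
  ... | no q≢q = contradiction refl q≢q
  after-++-∷ x (y ∷ pre) {q} (y∉ ∷ u) with y ≟ q
  ... | yes y≡q = contradiction y≡q (All.lookup y∉ (∈-++⁺ʳ pre (here refl)))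
  ... | no _    = after-++-∷ x pre u

  succIn-after : ∀ {x xs} → Unique (x ∷ xs) → ∀ pre q rest → x ∷ xs ≡ pre ++ q ∷ rest →
                 succIn (x ∷ xs) q ≡ fromMaybe x (head rest)
  succIn-after {x} {xs} u pre q rest eq = begin
    succIn (x ∷ xs) q            ≡⟨ succIn-∷ x xs q ⟩
    after x q (x ∷ xs)           ≡⟨ cong (after x q) eq ⟩
    after x q (pre ++ q ∷ rest)  ≡⟨ after-++-∷ x pre (subst Unique eq u) ⟩
    fromMaybe x (head rest)      ∎
    where open ≡-Reasoning

  iter-succIn-segment : ∀ {x xs} → Unique (x ∷ xs) → ∀ pre q seg rest →
                        x ∷ xs ≡ pre ++ q ∷ seg ++ rest →
                        iter {n} (succIn (x ∷ xs)) (suc (length seg)) q ≡ fromMaybe x (head rest)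
  iter-succIn-segment u pre q []        rest eq = succIn-after u pre q rest eq
  iter-succIn-segment {x} {xs} u pre q (z ∷ seg) rest eq = begin
    iter {n} (succIn (x ∷ xs)) (suc (suc (length seg))) q
      ≡⟨ iter-suc (succIn (x ∷ xs)) (suc (length seg)) q ⟩
    iter {n} (succIn (x ∷ xs)) (suc (length seg)) (succIn (x ∷ xs) q)
      ≡⟨ cong (iter {n} (succIn (x ∷ xs)) (suc (length seg)))
              (succIn-after u pre q (z ∷ seg ++ rest) eq) ⟩
    iter {n} (succIn (x ∷ xs)) (suc (length seg)) z
      ≡⟨ iter-succIn-segment u (pre ++ [ q ]) z seg rest (trans eq (sym (++-assoc pre [ q ] _))) ⟩
    fromMaybe x (head rest)                             ∎
    where open ≡-Reasoning

  succIn-periodic : ∀ {L p} → Unique L → p ∈ₗ L → ∃[ r ] iter {n} (succIn L) (suc r) p ≡ p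
  succIn-periodic {x ∷ xs} {p} u p∈ with ∈-∃++ p∈
  ... | [] , post , refl = length post , to-end
    where
    to-end : iter {n} (succIn (p ∷ post)) (suc (length post)) p ≡ p
    to-end = iter-succIn-segment u [] p post [] (cong (p ∷_) (sym (++-identityʳ post)))
  ... | (_ ∷ pre) , post , refl = length pre + suc (length post) , around
    where
    L : List (Fin n)
    L = x ∷ pre ++ p ∷ post
    around : iter {n} (succIn L) (suc (length pre) + suc (length post)) p ≡ p
    around = begin
      iter {n} (succIn L) (suc (length pre) + suc (length post)) p
        ≡⟨ iter-+ (succIn L) (suc (length pre)) (suc (length post)) p ⟩
      iter {n} (succIn L) (suc (length pre)) (iter {n} (succIn L) (suc (length post)) p)
        ≡⟨ cong (iter {n} (succIn L) (suc (length pre)))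
             (iter-succIn-segment u (x ∷ pre) p post []
                (cong (λ s → x ∷ pre ++ p ∷ s) (sym (++-identityʳ post)))) ⟩
      iter {n} (succIn L) (suc (length pre)) x
        ≡⟨ iter-succIn-segment u [] x pre (p ∷ post) refl ⟩
      p ∎
      where open ≡-Reasoning

  rotate : RotSys n → Dart → Dart
  rotate G d = proj₁ d , succIn (rot G (proj₁ d)) (proj₂ d)

  module _ {G : RotSys n} {A B : Subset n} {w : Fin n} (t : SpanTree G A B w) where

    IsChild : Fin n → Fin n → Set
    IsChild a b = a ∈ inT t × a ≢ w × parent t a ≡ b

    isChild-sound : ∀ {a b} → isChild t a b ≡ true → IsChild a b
    isChild-sound {a} {b} e with a ∈? inT t | a ≟ w | parent t a ≟ b
    isChild-sound () | no _  | _     | _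
    isChild-sound () | yes _ | yes _ | _
    isChild-sound () | yes _ | no _  | no _
    ... | yes a∈ | no a≢w | yes pa≡b = a∈ , a≢w , pa≡b

    isChild-complete : ∀ {a b} → IsChild a b → isChild t a b ≡ true
    isChild-complete {a} {b} (a∈ , a≢w , pa≡b) with a ∈? inT t | a ≟ w | parent t a ≟ b
    ... | yes _  | no _     | yes _    = refl
    ... | no a∉  | _        | _        = contradiction a∈ a∉
    ... | yes _  | yes a≡w  | _        = contradiction a≡w a≢w
    ... | yes _  | no _     | no pa≢b = contradiction pa≡b pa≢b

    isChild-false : ∀ {a b} → ¬ IsChild a b → isChild t a b ≡ false
    isChild-false ¬ab = ¬-not (¬ab ∘ isChild-sound)

    turn-tree : ∀ {a b} → isTreeEdge t a b ≡ true → turn t (a , b) ≡ rotate G (b , a)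
    turn-tree {a} {b} = cong (if_then rotate G (b , a) else rotate G (a , b))

    turn-rotate : ∀ {a b} → isTreeEdge t a b ≡ false → turn t (a , b) ≡ rotate G (a , b)
    turn-rotate {a} {b} = cong (if_then rotate G (b , a) else rotate G (a , b))

    height : Fin n → ℕ
    height x = max 0 (map (depth t) (allFin n)) ∸ depth t x

    child⇒height< : ∀ {z c} → IsChild z c → height z < height c
    child⇒height< {z} (z∈ , z≢w , refl) =
      ∸-monoʳ-< (par-depth t z z∈ z≢w)
        (All.lookup (map⁻ (xs≤max 0 (map (depth t) (allFin n)))) (∈-allFin z))

    IsChild-wellFounded : WellFounded IsChild
    IsChild-wellFounded = Subrelation.wellFounded child⇒height< (On.wellFounded height <-wellFounded)

    _↝_ : Dart → Dart → Set
    _↝_ = StepOutside (turn t) (λ d → proj₁ d ≡ w)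

    -- Turning at c past a child z enters the subtree of z, which is walked
    -- around (rotating at z, recursing into its children) until the tree edge
    -- {z, c} leads back.  The isChild hypothesis excludes the edge from c up
    -- to its parent.
    excursion : ∀ {c z} → Acc IsChild c → isChild t c z ≡ false →
                Star _↝_ (turn t (c , z)) (rotate G (c , z))
    around-subtree : ∀ {z c} → Acc IsChild z → IsChild z c →
              Star _↝_ (rotate G (z , c)) (rotate G (c , z))

    excursion {c} {z} (acc rs) c↛z = by-cases (isChild t z c) refl
      where
      starting-at : ∀ {d} → turn t (c , z) ≡ d → Star _↝_ d (rotate G (c , z)) →
                    Star _↝_ (turn t (c , z)) (rotate G (c , z))
      starting-at e = subst (λ d → Star _↝_ d (rotate G (c , z))) (sym e)
      by-cases : ∀ b → isChild t z c ≡ b → Star _↝_ (turn t (c , z)) (rotate G (c , z))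
      by-cases false z↛c = starting-at (turn-rotate (cong₂ _∨_ c↛z z↛c)) ε
      by-cases true  z→c = starting-at (turn-tree (cong₂ _∨_ c↛z z→c))
                             (around-subtree (rs (isChild-sound z→c)) (isChild-sound z→c))

    around-subtree {z} {c} acc-z z-child@(z∈ , z≢w , pz≡c) =
      around r (succIn (rot G z) c) (trans (sym (iter-suc (succIn (rot G z)) r c)) r-periodic)
        ◅◅ (z≢w , turn-tree (cong (_∨ isChild t c z) (isChild-complete z-child))) ◅ ε
      where
      period : ∃[ r ] iter {n} (succIn (rot G z)) (suc r) c ≡ c
      period = succIn-periodic (rot-uniq G z) (subst (_∈ₗ rot G z) pz≡c (par-adj t z z∈ z≢w))
      r = proj₁ period
      r-periodic = proj₂ period
      around : ∀ r u → iter {n} (succIn (rot G z)) r u ≡ c → Star _↝_ (z , u) (z , c)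
      around zero    u refl = ε
      around (suc r) u u↦c with u ≟ c
      ... | yes refl = ε
      ... | no u≢c =
        (z≢w , refl) ◅ excursion acc-z
                          (isChild-false λ (_ , _ , pz≡u) → u≢c (trans (sym pz≡u) pz≡c))
          ◅◅ around r _ (trans (sym (iter-suc (succIn (rot G z)) r u)) u↦c)

    turn-returns : ∀ {d} → proj₁ d ≡ w → Star _↝_ (turn t d) (rotate G d)
    turn-returns {_ , y} refl =
      excursion (IsChild-wellFounded w) (isChild-false λ (_ , w≢w , _) → w≢w refl)

    rotation-order : ∀ {x₁ x₂ x₃ x₄} → CycOrd {n} (succIn (rot G w)) x₁ x₂ x₃ x₄ →
                     CycOrd {n} (turn t) (w , x₁) (w , x₂) (w , x₃) (w , x₄)
    rotation-order =
      FirstReturn.CycOrd-firstReturn id turn-returns refl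
        ∘ CycOrd-map (w ,_) (cong proj₂) (λ _ → refl)

proposition1 : ∀ {n : ℕ} (G : RotSys n) (ι : Set) (V : ι → Subset n) →
    (∀ i → ConnectedIn G (V i)) →
    CrossFree G V →
    (v : Fin n) →
    AbabFree (rot G v) (Σ ι λ i → v ∈ V i)
      (λ e x → (x ∈ₗ rot G v) × (x ∈ V (proj₁ e)))
proposition1 G ι V _ cross-free v
  ((i , v∈i) , (j , v∈j) , x₁ , x₂ , x₃ , x₄ , x₁∈ , x₂∈ , x₃∈ , x₄∈ ,
   (_ , x₁∈i) , x₁∉j , (_ , x₃∈i) , x₃∉j , (_ , x₂∈j) , x₂∉i , (_ , x₄∈j) , x₄∉i , order)
  with t , no-crossing ← cross-free i j v v∈i v∈j
  = no-crossing
      ((v , x₁) , (v , x₂) , (v , x₃) , (v , x₄) ,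
       root-in t , root-in t , root-in t , root-in t , x₁∈ , x₂∈ , x₃∈ , x₄∈ ,
       x₁∈i , x₁∉j ∘ (x₁∈ ,_) , x₃∈i , x₃∉j ∘ (x₃∈ ,_) ,
       x₂∈j , x₂∉i ∘ (x₂∈ ,_) , x₄∈j , x₄∉i ∘ (x₄∈ ,_) ,
       rotation-order t order)
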